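{- For types $s,t\in\{\mathcal N,\mathcal O,\mathcal P,\mathcal Q\}$, let $S(s,t)$ be the set of types that $G+H$ can have as $G$ ranges over games of type $s$ and $H$ over games of type $t$. Then (with $S(s,t)=S(t,s)$): $S(\mathcal P,\mathcal P)=\{\mathcal P,\mathcal Q\}$, $S(\mathcal P,\mathcal N)=\{\mathcal N,\mathcal Q\}$, $S(\mathcal P,\mathcal O)=\{\mathcal O,\mathcal Q\}$, $S(\mathcal P,\mathcal Q)=\{\mathcal Q\}$, $S(\mathcal N,\mathcal N)=\{\mathcal N,\mathcal O,\mathcal Q\}$, $S(\mathcal N,\mathcal O)=\{\mathcal P,\mathcal N,\mathcal Q\}$, $S(\mathcal N,\mathcal Q)=\{\mathcal N,\mathcal Q\}$, $S(\mathcal O,\mathcal O)=\{\mathcal N,\mathcal Q\}$, $S(\mathcal O,\mathcal Q)=\{\mathcal N,\mathcal O,\mathcal Q\}$, $S(\mathcal Q,\mathcal Q)=\{\mathcal O,\mathcal Q\}$. That is, every listed combination is realized by some pair of games, and no unlisted combination is realized.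
   Context: A (finite impartial) game is defined recursively as a finite set of games, its options; $0$ is the game with no options. Three players alternate moves cyclically; a move replaces the current game by one of its options, and the player who makes the last move wins. The disjunctive sum $G+H$ is the game whose options are all $G'+H$ ($G'$ an option of $G$) and all $G+H'$ ($H'$ an option of $H$). Every game has exactly one type, defined recursively: $G$ is of type $\mathcal N$ iff it has some option of type $\mathcal P$; $G$ is of type $\mathcal O$ iff it has at least one option and all its options are of type $\mathcal N$; $G$ is of type $\mathcal P$ iff all its options are of type $\mathcal O$ (so $0$ is of type $\mathcal P$); $G$ is of type $\mathcal Q$ otherwise. (Equivalently: $\mathcal N$, $\mathcal O$, $\mathcal P$ mean that the player moving first, second, third respectively has a strategy winning against all play of the other two; $\mathcal Q$ means no player has such a strategy.) -}

module Defs where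

open import Data.Nat using (ℕ; zero; suc; _+_)
open import Data.Fin using (Fin; splitAt)
open import Data.Sum using ([_,_])
open import Data.Bool using (Bool; true; false; if_then_else_; _∧_)
open import Data.List using (List; []; _∷_; tabulate)
open import Data.Bool.ListAction using (any; all)

-- A finite impartial game: a finite (indexed) family of options.
-- Duplicates are harmless: the type of a game depends only on the set of its options.
data Game : Set where
  mk : (n : ℕ) → (Fin n → Game) → Game

zeroG : Game
zeroG = mk 0 (λ ())

infixl 6 _⊕_
_⊕_ : Game → Game → Game
mk m f ⊕ mk n g =
  mk (m + n) (λ i → [ (λ a → f a ⊕ mk n g) , (λ b → mk m f ⊕ g b) ] (splitAt m i))

-- The four outcome types for three-player games.
data Ty : Set where
  𝒩 𝒪 𝒫 𝒬 : Ty

isN isO isP : Ty → Bool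
isN 𝒩 = true
isN _ = false
isO 𝒪 = true
isO _ = false
isP 𝒫 = true
isP _ = false

nonEmpty : List Ty → Bool
nonEmpty [] = false
nonEmpty (_ ∷ _) = true

classify : List Ty → Ty
classify ts =
  if any isP ts then 𝒩
  else if nonEmpty ts ∧ all isN ts then 𝒪
  else if all isO ts then 𝒫
  else 𝒬

type : Game → Ty
type (mk n f) = classify (tabulate (λ i → type (f i)))

S : Ty → Ty → List Ty
S 𝒫 𝒫 = 𝒫 ∷ 𝒬 ∷ []
S 𝒫 𝒩 = 𝒩 ∷ 𝒬 ∷ []
S 𝒩 𝒫 = 𝒩 ∷ 𝒬 ∷ []
S 𝒫 𝒪 = 𝒪 ∷ 𝒬 ∷ []
S 𝒪 𝒫 = 𝒪 ∷ 𝒬 ∷ []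
S 𝒫 𝒬 = 𝒬 ∷ []
S 𝒬 𝒫 = 𝒬 ∷ []
S 𝒩 𝒩 = 𝒩 ∷ 𝒪 ∷ 𝒬 ∷ []
S 𝒩 𝒪 = 𝒫 ∷ 𝒩 ∷ 𝒬 ∷ []
S 𝒪 𝒩 = 𝒫 ∷ 𝒩 ∷ 𝒬 ∷ []
S 𝒩 𝒬 = 𝒩 ∷ 𝒬 ∷ []
S 𝒬 𝒩 = 𝒩 ∷ 𝒬 ∷ []
S 𝒪 𝒪 = 𝒩 ∷ 𝒬 ∷ []
S 𝒪 𝒬 = 𝒩 ∷ 𝒪 ∷ 𝒬 ∷ []
S 𝒬 𝒪 = 𝒩 ∷ 𝒪 ∷ 𝒬 ∷ []
S 𝒬 𝒬 = 𝒪 ∷ 𝒬 ∷ []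

{-# OPTIONS --safe #-}

-- By induction on pairs of positions: the type of G ⊕ H is determined by the
-- types of its options G′ ⊕ H and G ⊕ H′, and the induction hypothesis confines
-- those to the table S.  Each combination missing from S is then refuted by
-- looking one move ahead, except 𝒬 ⊕ 𝒬 = 𝒫 and 𝒪 ⊕ 𝒪 = 𝒪, which need two and
-- three moves.  Every combination listed in S is realised by sums of small games.

module Submission where

open import Defs
open import Data.Bool using (Bool; T; true; false; if_then_else_; _∧_)
open import Data.Bool.ListAction using (any; all)
open import Data.Bool.Properties using (T-∧)
open import Data.Empty using (⊥-elim)
open import Data.Fin using (Fin; zero; suc; splitAt; _↑ˡ_; _↑ʳ_)
open import Data.Fin.Properties using (splitAt-↑ˡ; splitAt-↑ʳ)
open import Data.List using (List; []; _∷_; tabulate; filter)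
open import Data.List.Membership.Propositional using (_∈_)
open import Data.List.Membership.Propositional.Properties using (∈-filter⁺)
open import Data.List.Relation.Unary.All as All using (All; []; _∷_)
open import Data.List.Relation.Unary.All.Properties using (all⁺; all⁻)
  renaming (tabulate⁻ to All-tabulate⁻)
open import Data.List.Relation.Unary.All.Properties.Core using (¬All⇒Any¬)
open import Data.List.Relation.Unary.Any as Any using (here; there)
open import Data.List.Relation.Unary.Any.Properties using (any⁺; any⁻; singleton⁻; ¬Any[])
  renaming (tabulate⁺ to Any-tabulate⁺; tabulate⁻ to Any-tabulate⁻)
open import Data.Nat using (ℕ; zero; suc)
open import Data.Product using (Σ; ∃-syntax; _×_; _,_; proj₁; proj₂)
open import Data.Sum using (_⊎_; inj₁; inj₂; [_,_])
open import Function using (_∘_; Equivalence)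
open import Function.Bundles using (_⇔_; mk⇔)
open import Relation.Binary.Definitions using (DecidableEquality)
open import Relation.Binary.PropositionalEquality using (_≡_; _≢_; refl; cong; subst)
open import Relation.Nullary using (¬_; yes; no; ¬?)
open import Relation.Nullary.Decidable using (False; T?; toWitnessFalse; decidable-stable)

arity : Game → ℕ
arity (mk n _) = n

option : (G : Game) → Fin (arity G) → Game
option (mk _ f) = f

_≟_ : DecidableEquality Ty
𝒩 ≟ 𝒩 = yes refl
𝒩 ≟ 𝒪 = no λ ()
𝒩 ≟ 𝒫 = no λ ()
𝒩 ≟ 𝒬 = no λ ()
𝒪 ≟ 𝒩 = no λ ()
𝒪 ≟ 𝒪 = yes refl
𝒪 ≟ 𝒫 = no λ ()
𝒪 ≟ 𝒬 = no λ ()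
𝒫 ≟ 𝒩 = no λ ()
𝒫 ≟ 𝒪 = no λ ()
𝒫 ≟ 𝒫 = yes refl
𝒫 ≟ 𝒬 = no λ ()
𝒬 ≟ 𝒩 = no λ ()
𝒬 ≟ 𝒪 = no λ ()
𝒬 ≟ 𝒫 = no λ ()
𝒬 ≟ 𝒬 = yes refl

open import Data.List.Membership.DecPropositional _≟_ using (_∈?_)

allTypes : List Ty
allTypes = 𝒩 ∷ 𝒪 ∷ 𝒫 ∷ 𝒬 ∷ []

∈-allTypes : ∀ t → t ∈ allTypes
∈-allTypes 𝒩 = here refl
∈-allTypes 𝒪 = there (here refl)
∈-allTypes 𝒫 = there (there (here refl))
∈-allTypes 𝒬 = there (there (there (here refl)))

T-isN : ∀ {t} → T (isN t) → t ≡ 𝒩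
T-isN {𝒩} _ = refl

T-isO : ∀ {t} → T (isO t) → t ≡ 𝒪
T-isO {𝒪} _ = refl

T-isP : ∀ {t} → T (isP t) → t ≡ 𝒫
T-isP {𝒫} _ = refl

¬T⇒≢ : ∀ {p : Ty → Bool} {t x} → T (p x) → ¬ T (p t) → t ≢ x
¬T⇒≢ px ¬pt refl = ¬pt px

-- The body of classify with its three tests abstracted, so that they can be matched on.
classifyBy : Bool → Bool → Bool → Ty
classifyBy p n o = if p then 𝒩 else if n then 𝒪 else if o then 𝒫 else 𝒬

classifyBy≡𝒩 : ∀ p n o → classifyBy p n o ≡ 𝒩 → T p
classifyBy≡𝒩 true  _     _     _ = _
classifyBy≡𝒩 false true  _     ()
classifyBy≡𝒩 false false true  ()
classifyBy≡𝒩 false false false ()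

classifyBy≡𝒪 : ∀ p n o → classifyBy p n o ≡ 𝒪 → T n
classifyBy≡𝒪 true  _     _     ()
classifyBy≡𝒪 false true  _     _ = _
classifyBy≡𝒪 false false true  ()
classifyBy≡𝒪 false false false ()

classifyBy≡𝒫 : ∀ p n o → classifyBy p n o ≡ 𝒫 → T o
classifyBy≡𝒫 true  _     _     ()
classifyBy≡𝒫 false true  _     ()
classifyBy≡𝒫 false false true  _ = _
classifyBy≡𝒫 false false false ()

classifyBy≡𝒬 : ∀ p n o → classifyBy p n o ≡ 𝒬 → ¬ T p × ¬ T n × ¬ T o
classifyBy≡𝒬 true  _     _     ()
classifyBy≡𝒬 false true  _     ()
classifyBy≡𝒬 false false true  ()
classifyBy≡𝒬 false false false _ = (λ ()) , (λ ()) , (λ ())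

module _ (ts : List Ty) where

  private
    p = any isP ts
    n = nonEmpty ts ∧ all isN ts
    o = all isO ts

  classify≡𝒩 : classify ts ≡ 𝒩 → T p
  classify≡𝒩 = classifyBy≡𝒩 p n o

  classify≡𝒪 : classify ts ≡ 𝒪 → T n
  classify≡𝒪 = classifyBy≡𝒪 p n o

  classify≡𝒫 : classify ts ≡ 𝒫 → T o
  classify≡𝒫 = classifyBy≡𝒫 p n o

  classify≡𝒬 : classify ts ≡ 𝒬 → ¬ T p × ¬ T n × ¬ T o
  classify≡𝒬 = classifyBy≡𝒬 p n o

optionTypes : Game → List Ty
optionTypes K = tabulate (λ a → type (option K a))

𝒩⇒𝒫-option : ∀ K → type K ≡ 𝒩 → ∃[ a ] type (option K a) ≡ 𝒫
𝒩⇒𝒫-option K@(mk _ _) e with Any-tabulate⁻ (any⁻ isP _ (classify≡𝒩 (optionTypes K) e))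
... | a , isP-a = a , T-isP isP-a

𝒪⇒𝒩-options : ∀ K → type K ≡ 𝒪 → ∀ a → type (option K a) ≡ 𝒩
𝒪⇒𝒩-options K@(mk _ _) e =
  T-isN ∘ All-tabulate⁻ (all⁺ isN _ (proj₂ (Equivalence.to T-∧ (classify≡𝒪 (optionTypes K) e))))

𝒫⇒𝒪-options : ∀ K → type K ≡ 𝒫 → ∀ a → type (option K a) ≡ 𝒪
𝒫⇒𝒪-options K@(mk _ _) e = T-isO ∘ All-tabulate⁻ (all⁺ isO _ (classify≡𝒫 (optionTypes K) e))

𝒬⇒no-𝒫-option : ∀ K → type K ≡ 𝒬 → ∀ a → type (option K a) ≢ 𝒫
𝒬⇒no-𝒫-option K@(mk _ _) e a =
  ¬T⇒≢ {isP} _ (proj₁ (classify≡𝒬 (optionTypes K) e) ∘ any⁺ isP ∘ Any-tabulate⁺ a)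

𝒬⇒non-𝒪-option : ∀ K → type K ≡ 𝒬 → ∃[ a ] type (option K a) ≢ 𝒪
𝒬⇒non-𝒪-option K@(mk _ _) e
  with Any-tabulate⁻ (¬All⇒Any¬ (T? ∘ isO) _
                        (proj₂ (proj₂ (classify≡𝒬 (optionTypes K) e)) ∘ all⁻ isO))
... | a , ¬isO = a , ¬T⇒≢ {isO} _ ¬isO

𝒬⇒non-𝒩-option : ∀ K → type K ≡ 𝒬 → ∃[ a ] type (option K a) ≢ 𝒩
𝒬⇒non-𝒩-option K@(mk (suc _) _) e
  with Any-tabulate⁻ (¬All⇒Any¬ (T? ∘ isN) _
                        (proj₁ (proj₂ (classify≡𝒬 (optionTypes K) e)) ∘ all⁻ isN))
... | a , ¬isN = a , ¬T⇒≢ {isN} _ ¬isN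

𝒪⇒𝒩-option : ∀ K → type K ≡ 𝒪 → ∃[ a ] type (option K a) ≡ 𝒩
𝒪⇒𝒩-option K@(mk (suc _) _) e = zero , 𝒪⇒𝒩-options K e zero

⊕-option⁻ : ∀ G H i →
  (∃[ a ] option (G ⊕ H) i ≡ option G a ⊕ H) ⊎ (∃[ b ] option (G ⊕ H) i ≡ G ⊕ option H b)
⊕-option⁻ (mk m _) (mk _ _) i with splitAt m i
... | inj₁ a = inj₁ (a , refl)
... | inj₂ b = inj₂ (b , refl)

⊕-optionˡ : ∀ G H a → ∃[ i ] option (G ⊕ H) i ≡ option G a ⊕ H
⊕-optionˡ (mk m _) (mk n _) a = a ↑ˡ n , cong [ _ , _ ] (splitAt-↑ˡ m a n)

⊕-optionʳ : ∀ G H b → ∃[ i ] option (G ⊕ H) i ≡ G ⊕ option H b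
⊕-optionʳ (mk m _) (mk n _) b = m ↑ʳ b , cong [ _ , _ ] (splitAt-↑ʳ m n b)

module _ (P : Game → Set) (G H : Game) where

  ⊕-all-options : (∀ i → P (option (G ⊕ H) i)) →
                  (∀ a → P (option G a ⊕ H)) × (∀ b → P (G ⊕ option H b))
  ⊕-all-options all-P =
    (λ a → let i , eq = ⊕-optionˡ G H a in subst P eq (all-P i)) ,
    (λ b → let i , eq = ⊕-optionʳ G H b in subst P eq (all-P i))

  ⊕-some-option : (∃[ i ] P (option (G ⊕ H) i)) →
                  (∃[ a ] P (option G a ⊕ H)) ⊎ (∃[ b ] P (G ⊕ option H b))
  ⊕-some-option (i , p) with ⊕-option⁻ G H i
  ... | inj₁ (a , eq) = inj₁ (a , subst P eq p)
  ... | inj₂ (b , eq) = inj₂ (b , subst P eq p)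

module _ (G H : Game) where

  ⊕≡𝒩 : type (G ⊕ H) ≡ 𝒩 →
        (∃[ a ] type (option G a ⊕ H) ≡ 𝒫) ⊎ (∃[ b ] type (G ⊕ option H b) ≡ 𝒫)
  ⊕≡𝒩 = ⊕-some-option (λ X → type X ≡ 𝒫) G H ∘ 𝒩⇒𝒫-option (G ⊕ H)

  ⊕≢𝒩 : (∀ a → type (option G a ⊕ H) ≢ 𝒫) → (∀ b → type (G ⊕ option H b) ≢ 𝒫) →
        type (G ⊕ H) ≢ 𝒩
  ⊕≢𝒩 ¬ˡ ¬ʳ e with ⊕≡𝒩 e
  ... | inj₁ (a , p) = ¬ˡ a p
  ... | inj₂ (b , p) = ¬ʳ b p

  ⊕≡𝒪ˡ : type (G ⊕ H) ≡ 𝒪 → ∀ a → type (option G a ⊕ H) ≡ 𝒩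
  ⊕≡𝒪ˡ = proj₁ ∘ ⊕-all-options (λ X → type X ≡ 𝒩) G H ∘ 𝒪⇒𝒩-options (G ⊕ H)

  ⊕≡𝒪ʳ : type (G ⊕ H) ≡ 𝒪 → ∀ b → type (G ⊕ option H b) ≡ 𝒩
  ⊕≡𝒪ʳ = proj₂ ∘ ⊕-all-options (λ X → type X ≡ 𝒩) G H ∘ 𝒪⇒𝒩-options (G ⊕ H)

  ⊕≡𝒫ˡ : type (G ⊕ H) ≡ 𝒫 → ∀ a → type (option G a ⊕ H) ≡ 𝒪
  ⊕≡𝒫ˡ = proj₁ ∘ ⊕-all-options (λ X → type X ≡ 𝒪) G H ∘ 𝒫⇒𝒪-options (G ⊕ H)

  ⊕≡𝒫ʳ : type (G ⊕ H) ≡ 𝒫 → ∀ b → type (G ⊕ option H b) ≡ 𝒪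
  ⊕≡𝒫ʳ = proj₂ ∘ ⊕-all-options (λ X → type X ≡ 𝒪) G H ∘ 𝒫⇒𝒪-options (G ⊕ H)

-- A record rather than a synonym, so that G and H can be inferred from a proof.
record Listed (G H : Game) : Set where
  constructor listed
  field ∈S : type (G ⊕ H) ∈ S (type G) (type H)

module _ {A B : Game} (AB-listed : Listed A B) where

  open Listed AB-listed

  refute : ∀ {s t u} → type A ≡ s → type B ≡ t → {False (u ∈? S s t)} → type (A ⊕ B) ≢ u
  refute refl refl {u∉S} refl = toWitnessFalse u∉S ∈S

  leftType∈ : ∀ {t u} → type B ≡ t → type (A ⊕ B) ≡ u →
              type A ∈ filter (λ s → u ∈? S s t) allTypes
  leftType∈ refl refl = ∈-filter⁺ (λ s → _ ∈? S s _) (∈-allTypes (type A)) ∈S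

  rightType∈ : ∀ {s u} → type A ≡ s → type (A ⊕ B) ≡ u →
               type B ∈ filter (λ t → u ∈? S s t) allTypes
  rightType∈ refl refl = ∈-filter⁺ (λ t → _ ∈? S _ t) (∈-allTypes (type B)) ∈S

∈S-unless-forbidden : ∀ s t {u} →
                      All (u ≢_) (filter (λ v → ¬? (v ∈? S s t)) allTypes) → u ∈ S s t
∈S-unless-forbidden s t {u} u≢forbidden = decidable-stable (u ∈? S s t) λ u∉S →
  All.lookup u≢forbidden (∈-filter⁺ (λ v → ¬? (v ∈? S s t)) (∈-allTypes u) u∉S) refl

data _≼_ (A : Game) : Game → Set where
  ≼-refl   : A ≼ A
  ≼-option : ∀ {G} a → A ≼ option G a → A ≼ G

_≺_ : Game → Game → Set
A ≺ G = ∃[ a ] A ≼ option G a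

module Step {G H : Game}
  (listedˡ : ∀ {A B} → A ≺ G → B ≼ H → Listed A B)
  (listedʳ : ∀ {B} → B ≺ H → Listed G B) where

  listed-optionˡ : ∀ a → Listed (option G a) H
  listed-optionˡ a = listedˡ (a , ≼-refl) ≼-refl

  listed-optionʳ : ∀ b → Listed G (option H b)
  listed-optionʳ b = listedʳ (b , ≼-refl)

  listed-options : ∀ a b → Listed (option G a) (option H b)
  listed-options a b = listedˡ (a , ≼-refl) (≼-option b ≼-refl)

  forcedˡ : ∀ {s t v} → (∃[ a ] type (option G a) ≡ s) → type H ≡ t → {False (v ∈? S s t)} →
            ¬ (∀ a → type (option G a ⊕ H) ≡ v)
  forcedˡ (a , eA) eH {v∉S} all-v = refute (listed-optionˡ a) eA eH {v∉S} (all-v a)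

  forcedʳ : ∀ {s t v} → type G ≡ s → (∃[ b ] type (option H b) ≡ t) → {False (v ∈? S s t)} →
            ¬ (∀ b → type (G ⊕ option H b) ≡ v)
  forcedʳ eG (b , eB) {v∉S} all-v = refute (listed-optionʳ b) eG eB {v∉S} (all-v b)

  𝒩⊕t≢𝒪 : ∀ {t} → type G ≡ 𝒩 → type H ≡ t → {False (𝒩 ∈? S 𝒫 t)} → type (G ⊕ H) ≢ 𝒪
  𝒩⊕t≢𝒪 eG eH {∉S} = forcedˡ (𝒩⇒𝒫-option G eG) eH {∉S} ∘ ⊕≡𝒪ˡ G H

  𝒩⊕t≢𝒫 : ∀ {t} → type G ≡ 𝒩 → type H ≡ t → {False (𝒪 ∈? S 𝒫 t)} → type (G ⊕ H) ≢ 𝒫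
  𝒩⊕t≢𝒫 eG eH {∉S} = forcedˡ (𝒩⇒𝒫-option G eG) eH {∉S} ∘ ⊕≡𝒫ˡ G H

  𝒪⊕t≢𝒫 : ∀ {t} → type G ≡ 𝒪 → type H ≡ t → {False (𝒪 ∈? S 𝒩 t)} → type (G ⊕ H) ≢ 𝒫
  𝒪⊕t≢𝒫 eG eH {∉S} = forcedˡ (𝒪⇒𝒩-option G eG) eH {∉S} ∘ ⊕≡𝒫ˡ G H

  s⊕𝒩≢𝒪 : ∀ {s} → type G ≡ s → type H ≡ 𝒩 → {False (𝒩 ∈? S s 𝒫)} → type (G ⊕ H) ≢ 𝒪
  s⊕𝒩≢𝒪 eG eH {∉S} = forcedʳ eG (𝒩⇒𝒫-option H eH) {∉S} ∘ ⊕≡𝒪ʳ G H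

  s⊕𝒩≢𝒫 : ∀ {s} → type G ≡ s → type H ≡ 𝒩 → {False (𝒪 ∈? S s 𝒫)} → type (G ⊕ H) ≢ 𝒫
  s⊕𝒩≢𝒫 eG eH {∉S} = forcedʳ eG (𝒩⇒𝒫-option H eH) {∉S} ∘ ⊕≡𝒫ʳ G H

  s⊕𝒪≢𝒫 : ∀ {s} → type G ≡ s → type H ≡ 𝒪 → {False (𝒪 ∈? S s 𝒩)} → type (G ⊕ H) ≢ 𝒫
  s⊕𝒪≢𝒫 eG eH {∉S} = forcedʳ eG (𝒪⇒𝒩-option H eH) {∉S} ∘ ⊕≡𝒫ʳ G H

  𝒫⊕𝒫≢𝒩 : type G ≡ 𝒫 → type H ≡ 𝒫 → type (G ⊕ H) ≢ 𝒩
  𝒫⊕𝒫≢𝒩 eG eH = ⊕≢𝒩 G H (λ a → refute (listed-optionˡ a) (𝒫⇒𝒪-options G eG a) eH)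
                           (λ b → refute (listed-optionʳ b) eG (𝒫⇒𝒪-options H eH b))

  𝒫⊕𝒫≢𝒪 : type G ≡ 𝒫 → type H ≡ 𝒫 → type (G ⊕ H) ≢ 𝒪
  𝒫⊕𝒫≢𝒪 eG eH eX with ⊕-some-option (λ X → type X ≡ 𝒩) G H (𝒪⇒𝒩-option (G ⊕ H) eX)
  ... | inj₁ (a , e) = refute (listed-optionˡ a) (𝒫⇒𝒪-options G eG a) eH e
  ... | inj₂ (b , e) = refute (listed-optionʳ b) eG (𝒫⇒𝒪-options H eH b) e

  𝒫⊕𝒪≢𝒩 : type G ≡ 𝒫 → type H ≡ 𝒪 → type (G ⊕ H) ≢ 𝒩
  𝒫⊕𝒪≢𝒩 eG eH = ⊕≢𝒩 G H (λ a → refute (listed-optionˡ a) (𝒫⇒𝒪-options G eG a) eH)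
                           (λ b → refute (listed-optionʳ b) eG (𝒪⇒𝒩-options H eH b))

  𝒪⊕𝒫≢𝒩 : type G ≡ 𝒪 → type H ≡ 𝒫 → type (G ⊕ H) ≢ 𝒩
  𝒪⊕𝒫≢𝒩 eG eH = ⊕≢𝒩 G H (λ a → refute (listed-optionˡ a) (𝒪⇒𝒩-options G eG a) eH)
                           (λ b → refute (listed-optionʳ b) eG (𝒫⇒𝒪-options H eH b))

  𝒫⊕𝒬≢𝒩 : type G ≡ 𝒫 → type H ≡ 𝒬 → type (G ⊕ H) ≢ 𝒩
  𝒫⊕𝒬≢𝒩 eG eH = ⊕≢𝒩 G H (λ a → refute (listed-optionˡ a) (𝒫⇒𝒪-options G eG a) eH)
    (λ b → 𝒬⇒no-𝒫-option H eH b ∘ singleton⁻ ∘ rightType∈ (listed-optionʳ b) eG)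

  𝒬⊕𝒫≢𝒩 : type G ≡ 𝒬 → type H ≡ 𝒫 → type (G ⊕ H) ≢ 𝒩
  𝒬⊕𝒫≢𝒩 eG eH = ⊕≢𝒩 G H
    (λ a → 𝒬⇒no-𝒫-option G eG a ∘ singleton⁻ ∘ leftType∈ (listed-optionˡ a) eH)
    (λ b → refute (listed-optionʳ b) eG (𝒫⇒𝒪-options H eH b))

  𝒬⊕𝒬≢𝒩 : type G ≡ 𝒬 → type H ≡ 𝒬 → type (G ⊕ H) ≢ 𝒩
  𝒬⊕𝒬≢𝒩 eG eH = ⊕≢𝒩 G H (λ a → ¬Any[] ∘ leftType∈ (listed-optionˡ a) eH)
                           (λ b → ¬Any[] ∘ rightType∈ (listed-optionʳ b) eG)

  𝒫⊕𝒬≢𝒪 : type G ≡ 𝒫 → type H ≡ 𝒬 → type (G ⊕ H) ≢ 𝒪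
  𝒫⊕𝒬≢𝒪 eG eH eX with 𝒬⇒non-𝒩-option H eH
  ... | b , b≢𝒩 = b≢𝒩 (singleton⁻ (rightType∈ (listed-optionʳ b) eG (⊕≡𝒪ʳ G H eX b)))

  𝒬⊕𝒫≢𝒪 : type G ≡ 𝒬 → type H ≡ 𝒫 → type (G ⊕ H) ≢ 𝒪
  𝒬⊕𝒫≢𝒪 eG eH eX with 𝒬⇒non-𝒩-option G eG
  ... | a , a≢𝒩 = a≢𝒩 (singleton⁻ (leftType∈ (listed-optionˡ a) eH (⊕≡𝒪ˡ G H eX a)))

  𝒫⊕𝒬≢𝒫 : type G ≡ 𝒫 → type H ≡ 𝒬 → type (G ⊕ H) ≢ 𝒫
  𝒫⊕𝒬≢𝒫 eG eH eX with 𝒬⇒non-𝒪-option H eH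
  ... | b , b≢𝒪 = b≢𝒪 (singleton⁻ (rightType∈ (listed-optionʳ b) eG (⊕≡𝒫ʳ G H eX b)))

  𝒬⊕𝒫≢𝒫 : type G ≡ 𝒬 → type H ≡ 𝒫 → type (G ⊕ H) ≢ 𝒫
  𝒬⊕𝒫≢𝒫 eG eH eX with 𝒬⇒non-𝒪-option G eG
  ... | a , a≢𝒪 = a≢𝒪 (singleton⁻ (leftType∈ (listed-optionˡ a) eH (⊕≡𝒫ˡ G H eX a)))

  𝒬⊕𝒬≢𝒫 : type G ≡ 𝒬 → type H ≡ 𝒬 → type (G ⊕ H) ≢ 𝒫
  𝒬⊕𝒬≢𝒫 eG eH eX with 𝒬⇒non-𝒪-option G eG | 𝒬⇒non-𝒪-option H eH
  ... | a , a≢𝒪 | b , b≢𝒪 =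
    refute (listed-options a b) G′≡𝒬 H′≡𝒬 (⊕≡𝒪ʳ (option G a) H G′⊕H≡𝒪 b)
    where
    G′⊕H≡𝒪 : type (option G a ⊕ H) ≡ 𝒪
    G′⊕H≡𝒪 = ⊕≡𝒫ˡ G H eX a
    G′≡𝒬 : type (option G a) ≡ 𝒬
    G′≡𝒬 = singleton⁻ (Any.tail a≢𝒪 (leftType∈ (listed-optionˡ a) eH G′⊕H≡𝒪))
    H′≡𝒬 : type (option H b) ≡ 𝒬
    H′≡𝒬 =
      singleton⁻ (Any.tail b≢𝒪 (rightType∈ (listed-optionʳ b) eG (⊕≡𝒫ʳ G H eX b)))

  -- Were G, H and G ⊕ H all 𝒪, the grandchildren G₂, H₂ found below would make
  -- G₂ ⊕ H₂ an 𝒩-game.  A 𝒫 option G₃ ⊕ H₂ of it forces G₃ to be 𝒪 (as H₂ is 𝒩), yet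
  -- G₃ ⊕ H, an option of the 𝒫-game G₂ ⊕ H, is then 𝒪, and 𝒪 ∉ S 𝒪 𝒪.
  -- Symmetrically for an option G₂ ⊕ H₃.
  module _ (eG : type G ≡ 𝒪) (eH : type H ≡ 𝒪) (eX : type (G ⊕ H) ≡ 𝒪) where

    𝒪⊕𝒪≡𝒪⇒grandchildˡ :
      ∃[ a ] ∃[ c ] type (option (option G a) c) ≡ 𝒩 × type (option (option G a) c ⊕ H) ≡ 𝒫
    𝒪⊕𝒪≡𝒪⇒grandchildˡ with 𝒪⇒𝒩-option G eG
    ... | a , G₁≡𝒩 with ⊕≡𝒩 (option G a) H (⊕≡𝒪ˡ G H eX a)
    ...   | inj₂ (b , e) = ⊥-elim (refute (listed-options a b) G₁≡𝒩 (𝒪⇒𝒩-options H eH b) e)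
    ...   | inj₁ (c , e) =
      a , c , singleton⁻ (leftType∈ (listedˡ (a , ≼-option c ≼-refl) ≼-refl) eH e) , e

    𝒪⊕𝒪≡𝒪⇒grandchildʳ :
      ∃[ b ] ∃[ d ] type (option (option H b) d) ≡ 𝒩 × type (G ⊕ option (option H b) d) ≡ 𝒫
    𝒪⊕𝒪≡𝒪⇒grandchildʳ with 𝒪⇒𝒩-option H eH
    ... | b , H₁≡𝒩 with ⊕≡𝒩 G (option H b) (⊕≡𝒪ʳ G H eX b)
    ...   | inj₁ (a , e) = ⊥-elim (refute (listed-options a b) (𝒪⇒𝒩-options G eG a) H₁≡𝒩 e)
    ...   | inj₂ (d , e) =
      b , d , singleton⁻ (rightType∈ (listedʳ (b , ≼-option d ≼-refl)) eG e) , e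

  𝒪⊕𝒪≢𝒪 : type G ≡ 𝒪 → type H ≡ 𝒪 → type (G ⊕ H) ≢ 𝒪
  𝒪⊕𝒪≢𝒪 eG eH eX with 𝒪⊕𝒪≡𝒪⇒grandchildˡ eG eH eX | 𝒪⊕𝒪≡𝒪⇒grandchildʳ eG eH eX
  ... | a , c , G₂≡𝒩 , G₂⊕H≡𝒫 | b , d , H₂≡𝒩 , G⊕H₂≡𝒫 =
    ⊕≢𝒩 G₂ H₂ no-𝒫ˡ no-𝒫ʳ (⊕≡𝒪ʳ G₂ (option H b) (⊕≡𝒫ʳ G₂ H G₂⊕H≡𝒫 b) d)
    where
    G₂ H₂ : Game
    G₂ = option (option G a) c
    H₂ = option (option H b) d
    no-𝒫ˡ : ∀ c′ → type (option G₂ c′ ⊕ H₂) ≢ 𝒫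
    no-𝒫ˡ c′ e = refute (listedˡ G₃≺G ≼-refl) G₃≡𝒪 eH (⊕≡𝒫ˡ G₂ H G₂⊕H≡𝒫 c′)
      where
      G₃≺G : option G₂ c′ ≺ G
      G₃≺G = a , ≼-option c (≼-option c′ ≼-refl)
      G₃≡𝒪 : type (option G₂ c′) ≡ 𝒪
      G₃≡𝒪 = singleton⁻ (leftType∈ (listedˡ G₃≺G H₂≼H) H₂≡𝒩 e)
        where
        H₂≼H : H₂ ≼ H
        H₂≼H = ≼-option b (≼-option d ≼-refl)
    no-𝒫ʳ : ∀ d′ → type (G₂ ⊕ option H₂ d′) ≢ 𝒫
    no-𝒫ʳ d′ e = refute (listedʳ H₃≺H) eG H₃≡𝒪 (⊕≡𝒫ʳ G H₂ G⊕H₂≡𝒫 d′)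
      where
      H₃≺H : option H₂ d′ ≺ H
      H₃≺H = b , ≼-option d (≼-option d′ ≼-refl)
      H₃≡𝒪 : type (option H₂ d′) ≡ 𝒪
      H₃≡𝒪 = singleton⁻ (rightType∈ (listedˡ (a , ≼-option c ≼-refl) H₃≼H) G₂≡𝒩 e)
        where
        H₃≼H : option H₂ d′ ≼ H
        H₃≼H = ≼-option b (≼-option d (≼-option d′ ≼-refl))

  step : Listed G H
  step = listed ∈S
    where
    ∈S : type (G ⊕ H) ∈ S (type G) (type H)
    ∈S with type G in eG | type H in eH
    ... | 𝒩 | 𝒩 = ∈S-unless-forbidden 𝒩 𝒩 (𝒩⊕t≢𝒫 eG eH ∷ [])
    ... | 𝒩 | 𝒪 = ∈S-unless-forbidden 𝒩 𝒪 (𝒩⊕t≢𝒪 eG eH ∷ [])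
    ... | 𝒩 | 𝒫 = ∈S-unless-forbidden 𝒩 𝒫 (𝒩⊕t≢𝒪 eG eH ∷ 𝒩⊕t≢𝒫 eG eH ∷ [])
    ... | 𝒩 | 𝒬 = ∈S-unless-forbidden 𝒩 𝒬 (𝒩⊕t≢𝒪 eG eH ∷ 𝒩⊕t≢𝒫 eG eH ∷ [])
    ... | 𝒪 | 𝒩 = ∈S-unless-forbidden 𝒪 𝒩 (s⊕𝒩≢𝒪 eG eH ∷ [])
    ... | 𝒪 | 𝒪 = ∈S-unless-forbidden 𝒪 𝒪 (𝒪⊕𝒪≢𝒪 eG eH ∷ 𝒪⊕t≢𝒫 eG eH ∷ [])
    ... | 𝒪 | 𝒫 = ∈S-unless-forbidden 𝒪 𝒫 (𝒪⊕𝒫≢𝒩 eG eH ∷ 𝒪⊕t≢𝒫 eG eH ∷ [])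
    ... | 𝒪 | 𝒬 = ∈S-unless-forbidden 𝒪 𝒬 (𝒪⊕t≢𝒫 eG eH ∷ [])
    ... | 𝒫 | 𝒩 = ∈S-unless-forbidden 𝒫 𝒩 (s⊕𝒩≢𝒪 eG eH ∷ s⊕𝒩≢𝒫 eG eH ∷ [])
    ... | 𝒫 | 𝒪 = ∈S-unless-forbidden 𝒫 𝒪 (𝒫⊕𝒪≢𝒩 eG eH ∷ s⊕𝒪≢𝒫 eG eH ∷ [])
    ... | 𝒫 | 𝒫 = ∈S-unless-forbidden 𝒫 𝒫 (𝒫⊕𝒫≢𝒩 eG eH ∷ 𝒫⊕𝒫≢𝒪 eG eH ∷ [])
    ... | 𝒫 | 𝒬 = ∈S-unless-forbidden 𝒫 𝒬 (𝒫⊕𝒬≢𝒩 eG eH ∷ 𝒫⊕𝒬≢𝒪 eG eH ∷ 𝒫⊕𝒬≢𝒫 eG eH ∷ [])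
    ... | 𝒬 | 𝒩 = ∈S-unless-forbidden 𝒬 𝒩 (s⊕𝒩≢𝒪 eG eH ∷ s⊕𝒩≢𝒫 eG eH ∷ [])
    ... | 𝒬 | 𝒪 = ∈S-unless-forbidden 𝒬 𝒪 (s⊕𝒪≢𝒫 eG eH ∷ [])
    ... | 𝒬 | 𝒫 = ∈S-unless-forbidden 𝒬 𝒫 (𝒬⊕𝒫≢𝒩 eG eH ∷ 𝒬⊕𝒫≢𝒪 eG eH ∷ 𝒬⊕𝒫≢𝒫 eG eH ∷ [])
    ... | 𝒬 | 𝒬 = ∈S-unless-forbidden 𝒬 𝒬 (𝒬⊕𝒬≢𝒩 eG eH ∷ 𝒬⊕𝒬≢𝒫 eG eH ∷ [])

-- Structural recursion, lexicographic in G and then H; quantifying over all positions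
-- A ≼ G and B ≼ H provides Step with its hypotheses.
≼-listed : ∀ {G H A B} → A ≼ G → B ≼ H → Listed A B
≼-listed {mk _ f} (≼-option a A≼) B≼ = ≼-listed {f a} A≼ B≼
≼-listed {G} {mk _ g} ≼-refl (≼-option b B≼) = ≼-listed {G} {g b} ≼-refl B≼
≼-listed {mk _ f} {mk _ g} ≼-refl ≼-refl =
  Step.step (λ (a , A≼) B≼ → ≼-listed {f a} A≼ B≼)
            (λ (b , B≼) → ≼-listed {mk _ f} {g b} ≼-refl B≼)

listed-sum : ∀ G H → Listed G H
listed-sum G H = ≼-listed ≼-refl ≼-refl

↑_ : Game → Game
↑ G = mk 1 λ _ → G

⟨_,_⟩ : Game → Game → Game
⟨ G , H ⟩ = mk 2 λ { zero → G ; (suc zero) → H }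

chain : ℕ → Game
chain zero    = zeroG
chain (suc n) = ↑ chain n

*2 : Game
*2 = ⟨ chain 0 , chain 1 ⟩

q : Game
q = ⟨ chain 1 , chain 2 ⟩

Realisable : Ty → Ty → Ty → Set
Realisable s t u = Σ Game (λ G → Σ Game (λ H → type G ≡ s × type H ≡ t × type (G ⊕ H) ≡ u))

infix 6 _&_

_&_ : (G H : Game) → Realisable (type G) (type H) (type (G ⊕ H))
G & H = G , H , refl , refl , refl

realisations : ∀ s t → All (Realisable s t) (S s t)
realisations 𝒩 𝒩 = chain 1 & ⟨ chain 0 , chain 2 ⟩ ∷ chain 1 & chain 1 ∷ chain 1 & *2 ∷ []
realisations 𝒩 𝒪 = chain 1 & chain 2 ∷ *2 & chain 2 ∷ chain 1 & ↑ *2 ∷ []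
realisations 𝒩 𝒫 = chain 1 & chain 0 ∷ chain 4 & ↑ ↑ *2 ∷ []
realisations 𝒩 𝒬 = chain 1 & q ∷ chain 1 & ↑ q ∷ []
realisations 𝒪 𝒩 = chain 2 & chain 1 ∷ chain 2 & *2 ∷ ↑ *2 & chain 1 ∷ []
realisations 𝒪 𝒪 = chain 2 & chain 2 ∷ chain 2 & ↑ *2 ∷ []
realisations 𝒪 𝒫 = chain 2 & chain 0 ∷ ↑ *2 & chain 3 ∷ []
realisations 𝒪 𝒬 = chain 2 & q ∷ chain 2 & ⟨ *2 , chain 2 ⟩ ∷ chain 2 & ↑ q ∷ []
realisations 𝒫 𝒩 = chain 0 & chain 1 ∷ ↑ ↑ *2 & chain 4 ∷ []
realisations 𝒫 𝒪 = chain 0 & chain 2 ∷ chain 3 & ↑ *2 ∷ []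
realisations 𝒫 𝒫 = chain 0 & chain 0 ∷ chain 3 & ↑ ↑ *2 ∷ []
realisations 𝒫 𝒬 = chain 0 & q ∷ []
realisations 𝒬 𝒩 = q & chain 1 ∷ ↑ q & chain 1 ∷ []
realisations 𝒬 𝒪 = q & chain 2 ∷ ⟨ *2 , chain 2 ⟩ & chain 2 ∷ ↑ q & chain 2 ∷ []
realisations 𝒬 𝒫 = q & chain 0 ∷ []
realisations 𝒬 𝒬 = q & q ∷ q & ↑ q ∷ []

mainTheorem1 : (s t u : Ty) →
    (Σ Game (λ G → Σ Game (λ H → type G ≡ s × type H ≡ t × type (G ⊕ H) ≡ u)))
      ⇔ (u ∈ S s t)
mainTheorem1 s t u =
  mk⇔ (λ { (G , H , refl , refl , refl) → Listed.∈S (listed-sum G H) })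
      (All.lookup (realisations s t))
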